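{- Let $K_m$ and $K_n$ be complete graphs on $m$ and $n$ vertices with $n\ge m\ge 3$. Then ${\rm dmg}(K_m\square K_n)=m$.
   Context: The Cartesian product $G\square H$ has vertex set $V(G)\times V(H)$, with $(u,v)\sim(u',v')$ iff ($u=u'$ and $vv'\in E(H)$) or ($v=v'$ and $uu'\in E(G)$). Damage game on a graph: one cop and one robber; in round $0$ the cop chooses a vertex, then the robber does; in each later round the cop moves to an adjacent vertex or passes, then the robber moves to an adjacent vertex or passes; the robber is captured if the cop occupies the robber's vertex. A vertex $v$ is damaged if the robber occupies $v$ in some round $i\ge0$ and in round $i+1$ the uncaptured robber passes or moves to a neighbour. The damage number ${\rm dmg}(\cdot)$ is the number of distinct vertices damaged when the cop plays to minimize and the robber to maximize this number. -}

module Defs where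

open import Data.Nat using (ℕ; zero; suc; _≤_)
open import Data.Fin using (Fin)
open import Data.List using (List; []; _∷_)
open import Data.Product using (Σ; ∃; _×_; _,_)
open import Data.Sum using (_⊎_)
open import Data.Empty using (⊥)
open import Relation.Nullary using (¬_)
open import Relation.Binary.PropositionalEquality using (_≡_; _≢_)
open import Function.Definitions using (Injective)

record Graph : Set₁ where
  field
    V   : Set
    Adj : V → V → Set
open Graph public

K : ℕ → Graph
K n = record { V = Fin n ; Adj = λ i j → i ≢ j }

_□_ : Graph → Graph → Graph
G □ H = record
  { V   = V G × V H
  ; Adj = λ { (u , v) (u' , v') →
              (u ≡ u' × Adj H v v') ⊎ (v ≡ v' × Adj G u u') } }

module Game (G : Graph) where
  Vx : Set
  Vx = V G

  -- History of completed rounds, most recent first: (cop position, robber position).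
  History : Set
  History = List (Vx × Vx)

  -- Cop chooses next position from the history; robber chooses from the history
  -- and the cop's just-chosen position.
  CopStrategy : Set
  CopStrategy = History → Vx

  RobberStrategy : Set
  RobberStrategy = History → Vx → Vx

  LegalMove : Vx → Vx → Set
  LegalMove x y = x ≡ y ⊎ Adj G x y

  -- In round 0 any vertex may be chosen; later moves must be legal.
  LegalCop : CopStrategy → Set
  LegalCop σ = ∀ c r h → LegalMove c (σ ((c , r) ∷ h))

  LegalRobber : RobberStrategy → Set
  LegalRobber τ = ∀ c r h c' → LegalMove r (τ ((c , r) ∷ h) c')

  module Play (σ : CopStrategy) (τ : RobberStrategy) where
    hist : ℕ → History
    hist zero    = []
    hist (suc k) = (σ (hist k) , τ (hist k) (σ (hist k))) ∷ hist k

    cop : ℕ → Vx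
    cop i = σ (hist i)

    rob : ℕ → Vx
    rob i = τ (hist i) (cop i)

    -- Robber is captured in round j (cop lands on robber, or robber on cop).
    CaughtAt : ℕ → Set
    CaughtAt zero    = cop zero ≡ rob zero
    CaughtAt (suc j) = cop (suc j) ≡ rob j ⊎ cop (suc j) ≡ rob (suc j)

    FreeThrough : ℕ → Set
    FreeThrough i = ∀ j → j ≤ i → ¬ CaughtAt j

    -- v is damaged: robber on v at end of round i, uncaptured, and not captured
    -- by the cop's move in round i+1 (so the robber then passes or moves).
    Damaged : Vx → Set
    Damaged v = ∃ λ i → rob i ≡ v × FreeThrough i × cop (suc i) ≢ rob i

  open Play public

  DamageAtLeast : CopStrategy → RobberStrategy → ℕ → Set
  DamageAtLeast σ τ k =
    Σ (Fin k → Vx) λ f → Injective _≡_ _≡_ f × (∀ x → Damaged σ τ (f x))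

  DmgIs : ℕ → Set
  DmgIs k =
    (Σ CopStrategy λ σ → LegalCop σ ×
       (∀ τ → LegalRobber τ → ¬ DamageAtLeast σ τ (suc k)))
    × (∀ σ → LegalCop σ →
         Σ RobberStrategy λ τ → LegalRobber τ × DamageAtLeast σ τ k)

dmg≡ : Graph → ℕ → Set
dmg≡ G k = Game.DmgIs G k

-- Call two vertices of Kₘ □ Kₙ (a rook's board with m rows and n columns) safe from
-- each other when they share neither row nor column; a cop can only catch a robber
-- who is not safe from him.
--
-- Upper bound: the cop always moves to the robber's row, staying in his own column.
-- A robber who is to damage his vertex must then leave that row, i.e. move within
-- his column; so everything he damages lies in his starting column, at most m vertices.
--
-- Lower bound: a robber at u, safe from the cop before the cop's move to w ≠ u, has
-- at least m − 1 neighbours safe from w (for n ≥ m and n ≥ 3), so as long as fewer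
-- than m − 1 other vertices have been visited he can step to a fresh safe vertex.
-- Doing so for m rounds damages m distinct vertices.
module Submission where

open import Defs
open import Data.Nat using (ℕ; zero; suc; _+_; _≤_; _<_; s≤s; z≤n)
open import Data.Nat.Properties using (<⇒≤; <⇒≱; ≤-<-trans; <-cmp; m<n⇒m<1+n; m≤n⇒m<n∨m≡n; n<1+n; ≤-refl; ≤-reflexive)
open import Data.Fin using (Fin; zero; suc; toℕ; punchIn; punchOut; inject≤; _≟_)
open import Data.Fin.Properties using (punchInᵢ≢i; punchIn-injective; punchIn-punchOut; inject≤-injective; toℕ-injective; toℕ<n; ¬∀⟶∃¬; injective⇒≤; <⇒notInjective) renaming (any? to anyFin?)
open import Data.List using (List; []; _∷_; map; length; lookup)
open import Data.List.Relation.Unary.Any using (here; there; index)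
open import Data.List.Relation.Unary.Any.Properties using (lookup-index)
open import Data.List.Membership.Propositional using (_∈_; _∉_)
open import Data.Product using (∃; Σ; _×_; _,_; proj₁; proj₂)
open import Data.Product.Properties using (≡-dec)
open import Data.Sum using (inj₁; inj₂)
open import Function using (_∘_)
open import Function.Definitions using (Injective)
open import Relation.Nullary using (¬_; Dec; yes; no; contradiction)
open import Relation.Nullary.Decidable using (_×-dec_; _⊎-dec_; ¬?; decidable-stable)
open import Level using (0ℓ)
open import Relation.Unary using (Pred; Decidable)
open import Relation.Binary.Definitions using (DecidableEquality; tri<; tri≈; tri>)
open import Relation.Binary.PropositionalEquality using (_≡_; _≢_; refl; sym; trans; cong; cong₂; subst; module ≡-Reasoning)

module _ {A : Set} (_≟ᴬ_ : DecidableEquality A) where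
  open import Data.List.Membership.DecPropositional _≟ᴬ_ using (_∈?_)

  -- If all k values of g lay in xs, their positions would inject Fin k into Fin (length xs).
  injective-image-∉ : ∀ {k} (g : Fin k → A) → Injective _≡_ _≡_ g →
                      (xs : List A) → length xs < k → ∃ λ i → g i ∉ xs
  injective-image-∉ {k} g g-inj xs len<k =
    ¬∀⟶∃¬ k (λ i → g i ∈ xs) (λ i → g i ∈? xs)
      (λ all∈ → <⇒≱ len<k (injective⇒≤ (position-injective all∈)))
    where
    position-injective : (all∈ : ∀ i → g i ∈ xs) → Injective _≡_ _≡_ (λ i → index (all∈ i))
    position-injective all∈ {i} {j} eq = g-inj (begin
      g i                       ≡⟨ lookup-index (all∈ i) ⟩
      lookup xs (index (all∈ i)) ≡⟨ cong (lookup xs) eq ⟩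
      lookup xs (index (all∈ j)) ≡⟨ sym (lookup-index (all∈ j)) ⟩
      g j                       ∎)
      where open ≡-Reasoning

∃∉-Fin : ∀ {n} (xs : List (Fin n)) → length xs < n → ∃ λ z → z ∉ xs
∃∉-Fin xs = injective-image-∉ _≟_ (λ z → z) (λ eq → eq) xs

punchIn₂ : ∀ {k} {x p : Fin (suc (suc k))} → x ≢ p → Fin k → Fin (suc (suc k))
punchIn₂ {x = x} x≢p j = punchIn x (punchIn (punchOut x≢p) j)

punchIn₂≢ˡ : ∀ {k} {x p : Fin (suc (suc k))} (x≢p : x ≢ p) j → punchIn₂ x≢p j ≢ x
punchIn₂≢ˡ {x = x} x≢p j = punchInᵢ≢i x _

punchIn₂≢ʳ : ∀ {k} {x p : Fin (suc (suc k))} (x≢p : x ≢ p) j → punchIn₂ x≢p j ≢ p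
punchIn₂≢ʳ {x = x} x≢p j eq =
  punchInᵢ≢i (punchOut x≢p) j (punchIn-injective x _ _ (trans eq (sym (punchIn-punchOut x≢p))))

punchIn₂-injective : ∀ {k} {x p : Fin (suc (suc k))} (x≢p : x ≢ p) → Injective _≡_ _≡_ (punchIn₂ x≢p)
punchIn₂-injective {x = x} x≢p = punchIn-injective (punchOut x≢p) _ _ ∘ punchIn-injective x _ _

module _ {A : Set} where

  choose : {P : Pred A 0ℓ} → Dec (∃ P) → A → A
  choose (yes (v , _)) _ = v
  choose (no _)        d = d

  choose-satisfies : {P : Pred A 0ℓ} (P? : Dec (∃ P)) (d : A) → ∃ P → P (choose P? d)
  choose-satisfies (yes (_ , pv)) _ _  = pv
  choose-satisfies (no ¬∃P)       _ ex = contradiction ex ¬∃P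

  choose-preserves : {P Q : Pred A 0ℓ} (P? : Dec (∃ P)) (d : A) → (∀ {v} → P v → Q v) → Q d → Q (choose P? d)
  choose-preserves (yes (_ , pv)) _ P⇒Q _  = P⇒Q pv
  choose-preserves (no _)         _ _   qd = qd

module Board {m n : ℕ} where
  open Game (K m □ K n) using (LegalMove; CopStrategy; RobberStrategy; LegalCop; LegalRobber; module Play; DamageAtLeast)

  Vertex : Set
  Vertex = Fin m × Fin n

  Adjacent : Vertex → Vertex → Set
  Adjacent = Adj (K m □ K n)

  row : Vertex → Fin m
  row = proj₁

  col : Vertex → Fin n
  col = proj₂

  Safe : Vertex → Vertex → Set
  Safe c r = row r ≢ row c × col r ≢ col c

  safe? : ∀ c r → Dec (Safe c r)
  safe? c r = ¬? (row r ≟ row c) ×-dec ¬? (col r ≟ col c)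

  _≟ᵛ_ : DecidableEquality Vertex
  _≟ᵛ_ = ≡-dec _≟_ _≟_

  adjacent? : ∀ u v → Dec (Adjacent u v)
  adjacent? u v = (row u ≟ row v ×-dec ¬? (col u ≟ col v)) ⊎-dec (col u ≟ col v ×-dec ¬? (row u ≟ row v))

  legal? : ∀ u v → Dec (LegalMove u v)
  legal? u v = (u ≟ᵛ v) ⊎-dec adjacent? u v

  open import Data.List.Membership.DecPropositional _≟ᵛ_ public using () renaming (_∈?_ to _∈ᵛ?_)

  any?-Vertex : {P : Pred Vertex 0ℓ} → Decidable P → Dec (∃ P)
  any?-Vertex P? with anyFin? (λ x → anyFin? (λ y → P? (x , y)))
  ... | yes (x , y , p) = yes ((x , y) , p)
  ... | no ¬p           = no λ { ((x , y) , p) → ¬p (x , y , p) }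

  adjacent⇒≢ : ∀ {u v} → Adjacent u v → u ≢ v
  adjacent⇒≢ (inj₁ (_ , cols≢)) refl = cols≢ refl
  adjacent⇒≢ (inj₂ (_ , rows≢)) refl = rows≢ refl

  legal-move-misses-safe : ∀ {c c' r} → LegalMove c c' → Safe c r → c' ≢ r
  legal-move-misses-safe (inj₁ refl)             (rows≢ , _) refl = rows≢ refl
  legal-move-misses-safe (inj₂ (inj₁ (eq , _))) (rows≢ , _) refl = rows≢ (sym eq)
  legal-move-misses-safe (inj₂ (inj₂ (eq , _))) (_ , cols≢) refl = cols≢ (sym eq)

  unsafe⇒legal : ∀ c r → ¬ Safe c r → LegalMove c r
  unsafe⇒legal c r ¬safe with row r ≟ row c | col r ≟ col c
  ... | yes rows≡ | yes cols≡ = inj₁ (sym (cong₂ _,_ rows≡ cols≡))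
  ... | yes rows≡ | no cols≢  = inj₂ (inj₁ (sym rows≡ , cols≢ ∘ sym))
  ... | no rows≢  | yes cols≡ = inj₂ (inj₂ (sym cols≡ , rows≢ ∘ sym))
  ... | no rows≢  | no cols≢  = contradiction (rows≢ , cols≢) ¬safe

  legal-off-row-keeps-column : ∀ {r r'} → row r' ≢ row r → LegalMove r r' → col r' ≡ col r
  legal-off-row-keeps-column rows≢ (inj₁ refl)             = contradiction refl rows≢
  legal-off-row-keeps-column rows≢ (inj₂ (inj₁ (eq , _))) = contradiction (sym eq) rows≢
  legal-off-row-keeps-column _     (inj₂ (inj₂ (eq , _))) = sym eq

  chase : Vertex → Vertex → Vertex
  chase c r with safe? c r
  ... | yes _ = (row r , col c)
  ... | no _  = r

  chase-safe : ∀ c r → Safe c r → chase c r ≡ (row r , col c)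
  chase-safe c r safe with safe? c r
  ... | yes _    = refl
  ... | no ¬safe = contradiction safe ¬safe

  chase-unsafe : ∀ c r → ¬ Safe c r → chase c r ≡ r
  chase-unsafe c r ¬safe with safe? c r
  ... | yes safe = contradiction safe ¬safe
  ... | no _     = refl

  chase-legal : ∀ c r → LegalMove c (chase c r)
  chase-legal c r with safe? c r
  ... | yes (rows≢ , _) = inj₂ (inj₂ (refl , rows≢ ∘ sym))
  ... | no ¬safe        = unsafe⇒legal c r ¬safe

  rowCop : Vertex → CopStrategy
  rowCop start []            = start
  rowCop _     ((c , r) ∷ _) = chase c r

  rowCop-legal : ∀ start → LegalCop (rowCop start)
  rowCop-legal _ c r _ = chase-legal c r

  module RowCopBound (start : Vertex) (τ : RobberStrategy) (τ-legal : LegalRobber τ) where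
    open Play (rowCop start) τ

    escaping-robber-was-safe : ∀ i → cop (suc i) ≢ rob i → Safe (cop i) (rob i)
    escaping-robber-was-safe i escapes = decidable-stable (safe? _ _) (escapes ∘ chase-unsafe (cop i) (rob i))

    escaping-robber-column : ∀ i → FreeThrough i → cop (suc i) ≢ rob i → col (rob i) ≡ col (rob 0)
    escaping-robber-column zero    _    _       = refl
    escaping-robber-column (suc i) free escapes = trans step (escaping-robber-column i free′ escaped)
      where
      free′ : FreeThrough i
      free′ j j≤i = free j (<⇒≤ (s≤s j≤i))
      escaped : cop (suc i) ≢ rob i
      escaped = free (suc i) ≤-refl ∘ inj₁
      left-row : row (rob (suc i)) ≢ row (rob i)
      left-row eq = proj₁ (escaping-robber-was-safe (suc i) escapes)
        (trans eq (cong row (sym (chase-safe (cop i) (rob i) (escaping-robber-was-safe i escaped)))))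
      step : col (rob (suc i)) ≡ col (rob i)
      step = legal-off-row-keeps-column left-row (τ-legal (cop i) (rob i) (hist i) (cop (suc i)))

    damage-bound : ¬ DamageAtLeast (rowCop start) τ (suc m)
    damage-bound (f , f-inj , damaged) = <⇒notInjective (n<1+n m) rows-injective
      where
      same-column : ∀ x → col (f x) ≡ col (rob 0)
      same-column x with damaged x
      ... | i , rob≡ , free , escapes = subst (λ v → col v ≡ col (rob 0)) rob≡ (escaping-robber-column i free escapes)
      rows-injective : Injective _≡_ _≡_ (row ∘ f)
      rows-injective {x} {y} eq = f-inj (cong₂ _,_ eq (trans (same-column x) (sym (same-column y))))

open Board

safe-neighbours : ∀ {k l} → k ≤ l → 1 < l → (c r : Fin (suc k) × Fin (suc l)) → c ≢ r →
                  Σ (Fin k → Fin (suc k) × Fin (suc l)) λ g → Injective _≡_ _≡_ g × (∀ i → Adjacent r (g i) × Safe c (g i))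
safe-neighbours {zero}  _   _   _       _       _   = (λ ()) , (λ {}) , λ ()
safe-neighbours {suc k} {l} k≤l 1<l (p , q) (x , y) c≢r with x ≟ p | y ≟ q
... | yes refl | yes refl = contradiction refl c≢r
... | yes refl | no y≢q  =
  (λ i → punchIn x i , y) ,
  (punchIn-injective x _ _ ∘ cong row) ,
  λ i → inj₂ (refl , punchInᵢ≢i x i ∘ sym) , punchInᵢ≢i x i , y≢q
... | no x≢p  | yes refl =
  (λ i → x , punchIn y (inject≤ i k≤l)) ,
  (inject≤-injective k≤l k≤l _ _ ∘ punchIn-injective y _ _ ∘ cong col) ,
  λ i → inj₁ (refl , punchInᵢ≢i y _ ∘ sym) , x≢p , punchInᵢ≢i y _
... | no x≢p  | no y≢q with ∃∉-Fin (y ∷ q ∷ []) (s≤s 1<l)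
...   | z , z∉ = g , g-injective , g-safe-neighbour
  where
  -- One neighbour in the robber's row, the other k in his column.
  g : Fin (suc k) → Fin (suc (suc k)) × Fin (suc l)
  g zero    = x , z
  g (suc j) = punchIn₂ x≢p j , y
  g-injective : Injective _≡_ _≡_ g
  g-injective {zero}  {zero}  _  = refl
  g-injective {zero}  {suc _} eq = contradiction (cong col eq) (z∉ ∘ here)
  g-injective {suc _} {zero}  eq = contradiction (cong col (sym eq)) (z∉ ∘ here)
  g-injective {suc _} {suc _} eq = cong suc (punchIn₂-injective x≢p (cong row eq))
  g-safe-neighbour : ∀ i → Adjacent (x , y) (g i) × Safe (p , q) (g i)
  g-safe-neighbour zero    = inj₁ (refl , z∉ ∘ here ∘ sym) , x≢p , z∉ ∘ there ∘ here
  g-safe-neighbour (suc j) = inj₂ (refl , punchIn₂≢ˡ x≢p j ∘ sym) , punchIn₂≢ʳ x≢p j , y≢q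

-- A board with m = suc k rows and n = suc l columns, where 2 ≤ m ≤ n and 3 ≤ n.
module FreshRobber {k l : ℕ} (0<k : 0 < k) (k≤l : k ≤ l) (1<l : 1 < l) where
  open Game (K (suc k) □ K (suc l)) using (LegalMove; CopStrategy; RobberStrategy; LegalRobber; LegalCop; History; module Play; DamageAtLeast)

  initial-safe : ∀ c → ∃ (Safe c)
  initial-safe c with ∃∉-Fin (row c ∷ []) (s≤s 0<k) | ∃∉-Fin (col c ∷ []) (m<n⇒m<1+n 1<l)
  ... | x , x∉ | y , y∉ = (x , y) , x∉ ∘ here , y∉ ∘ here

  fresh-safe-move : ∀ c r → c ≢ r → (seen : List Vertex) → length seen < k →
                    ∃ λ v → Adjacent r v × Safe c v × v ∉ r ∷ seen
  fresh-safe-move c r c≢r seen len<k with safe-neighbours k≤l 1<l c r c≢r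
  ... | g , g-inj , g-safe with injective-image-∉ _≟ᵛ_ g g-inj seen len<k
  ...   | i , g[i]∉seen with g-safe i
  ...     | adj , safe = g i , adj , safe , λ { (here eq)         → adjacent⇒≢ adj (sym eq)
                                              ; (there g[i]∈seen) → g[i]∉seen g[i]∈seen }

  Evasion : Vertex → Vertex → List Vertex → Vertex → Set
  Evasion r c' seen v = LegalMove r v × Safe c' v × v ∉ seen

  evasion? : ∀ r c' seen → Decidable (Evasion r c' seen)
  evasion? r c' seen v = legal? r v ×-dec safe? c' v ×-dec ¬? (v ∈ᵛ? seen)

  trail : History → List Vertex
  trail = map proj₂

  freshRobber : RobberStrategy
  freshRobber []              c' = choose (any?-Vertex (safe? c')) c'
  freshRobber h@((_ , r) ∷ _) c' = choose (any?-Vertex (evasion? r c' (trail h))) r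

  freshRobber-legal : LegalRobber freshRobber
  freshRobber-legal c r h c' =
    choose-preserves {Q = LegalMove r} (any?-Vertex (evasion? r c' (trail ((c , r) ∷ h)))) r proj₁ (inj₁ refl)

  module Against (σ : CopStrategy) (σ-legal : LegalCop σ) where
    open Play σ freshRobber

    trail-length : ∀ i → length (trail (hist i)) ≡ i
    trail-length zero    = refl
    trail-length (suc i) = cong suc (trail-length i)

    evasion-exists : ∀ i → i < k → Safe (cop i) (rob i) → ∃ (Evasion (rob i) (cop (suc i)) (trail (hist (suc i))))
    evasion-exists i i<k safe-i
      with fresh-safe-move (cop (suc i)) (rob i) (legal-move-misses-safe (σ-legal _ _ _) safe-i)
                           (trail (hist i)) (≤-<-trans (≤-reflexive (trail-length i)) i<k)
    ... | v , adj , safe , fresh = v , inj₂ adj , safe , fresh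

    safe-and-fresh : ∀ i → i < suc k → Safe (cop i) (rob i) × rob i ∉ trail (hist i)
    safe-and-fresh zero    _         =
      choose-satisfies (any?-Vertex (safe? (cop 0))) (cop 0) (initial-safe (cop 0)) , λ ()
    safe-and-fresh (suc i) (s≤s i<k) =
      proj₂ (choose-satisfies (any?-Vertex (evasion? (rob i) (cop (suc i)) (trail (hist (suc i))))) (rob i)
                              (evasion-exists i i<k (proj₁ (safe-and-fresh i (m<n⇒m<1+n i<k)))))

    safe : ∀ {i} → i < suc k → Safe (cop i) (rob i)
    safe = proj₁ ∘ safe-and-fresh _

    escapes : ∀ {i} → i < suc k → cop (suc i) ≢ rob i
    escapes i<m = legal-move-misses-safe (σ-legal _ _ _) (safe i<m)

    never-caught : ∀ {j} → j < suc k → ¬ CaughtAt j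
    never-caught {zero}  j<m       eq        = proj₁ (safe j<m) (cong row (sym eq))
    never-caught {suc j} (s≤s j<k) (inj₁ eq) = escapes (m<n⇒m<1+n j<k) eq
    never-caught {suc j} j<m       (inj₂ eq) = proj₁ (safe j<m) (cong row (sym eq))

    visited : ∀ {i j} → j < i → rob j ∈ trail (hist i)
    visited {suc i} (s≤s j≤i) with m≤n⇒m<n∨m≡n j≤i
    ... | inj₁ j<i  = there (visited j<i)
    ... | inj₂ refl = here refl

    rob-distinct : ∀ {i j} → j < i → i < suc k → rob j ≢ rob i
    rob-distinct j<i i<m eq = proj₂ (safe-and-fresh _ i<m) (subst (_∈ trail (hist _)) eq (visited j<i))

    rob-injective : ∀ {i j} → i < suc k → j < suc k → rob i ≡ rob j → i ≡ j
    rob-injective {i} {j} i<m j<m eq with <-cmp i j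
    ... | tri< i<j _ _ = contradiction eq (rob-distinct i<j j<m)
    ... | tri≈ _ i≡j _ = i≡j
    ... | tri> _ _ j<i = contradiction (sym eq) (rob-distinct j<i i<m)

    damage : DamageAtLeast σ freshRobber (suc k)
    damage = rob ∘ toℕ , (toℕ-injective ∘ rob-injective (toℕ<n _) (toℕ<n _)) ,
             λ x → toℕ x , refl , (λ j j≤i → never-caught (≤-<-trans j≤i (toℕ<n x))) , escapes (toℕ<n x)

theorem9 : (m n : ℕ) → 3 ≤ m → m ≤ n → dmg≡ (K m □ K n) m
theorem9 (suc (suc (suc a))) (suc (suc (suc b))) (s≤s (s≤s (s≤s _))) (s≤s (s≤s (s≤s a≤b))) =
  (rowCop corner , rowCop-legal corner , RowCopBound.damage-bound corner) ,
  λ σ σ-legal → freshRobber , freshRobber-legal , Against.damage σ σ-legal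
  where
  corner : Fin (3 + a) × Fin (3 + b)
  corner = zero , zero
  open FreshRobber {suc (suc a)} {suc (suc b)} (s≤s z≤n) (s≤s (s≤s a≤b)) (s≤s (s≤s z≤n))
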